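{- There exists an absolute constant $c>0$ such that for every $N$ there is a convex set $A\subset\mathbb{R}$ with $|A|\geq N$ containing at least $c|A|^{3/2}$ non-trivial three-term arithmetic progressions.
   Context: A convex set is a finite set $A=\{a_1<\cdots<a_n\}\subset\mathbb{R}$ whose consecutive differences $d_i=a_{i+1}-a_i$ ($1\le i\le n-1$) form a strictly increasing sequence. A three-term arithmetic progression in $A$ is a triple $(a,b,c)\in A^3$ with $2a=b+c$; it is non-trivial unless $a=b=c$. -}

module Defs where

open import Data.Nat using (ℕ; zero; suc)
open import Data.Integer using (ℤ; _-_; _+_; _*_; _<_; _≟_; +_)
open import Data.List using (List; []; _∷_; length)
open import Data.List.Relation.Unary.Linked using (Linked)
open import Data.Bool using (Bool; true; false; if_then_else_; _∧_; not)
open import Data.Product using (_×_)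
open import Relation.Nullary.Decidable using (⌊_⌋)

diffs : List ℤ → List ℤ
diffs (x ∷ y ∷ xs) = (y - x) ∷ diffs (y ∷ xs)
diffs _ = []

-- A finite set A = {a_1 < ... < a_n}, given as its increasing list of
-- elements, is convex if the consecutive differences strictly increase.
Convex : List ℤ → Set
Convex A = Linked _<_ A × Linked _<_ (diffs A)

isNT3AP : ℤ → ℤ → ℤ → Bool
isNT3AP a b c = ⌊ (+ 2) * a ≟ b + c ⌋ ∧ not (⌊ a ≟ b ⌋ ∧ ⌊ b ≟ c ⌋)

countOver : (ℤ → Bool) → List ℤ → ℕ
countOver p [] = zero
countOver p (x ∷ xs) = if p x then suc (countOver p xs) else countOver p xs

sumOver : (ℤ → ℕ) → List ℤ → ℕ
sumOver f [] = zero
sumOver f (x ∷ xs) = f x Data.Nat.+ sumOver f xs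

numNT3AP : List ℤ → ℕ
numNT3AP A = sumOver (λ a → sumOver (λ b → countOver (isNT3AP a b) A) A) A

-- A is given by its sequence of consecutive differences, cut into m = 3M blocks.  Block i
-- consists of about Q / (m + i) differences of size about (m + i) V with V huge, so the
-- differences increase from block to block, and every block has the same sum W.  Block i
-- starts at i W and begins with the differences (m + i) V, (m + i) V + 1, ..., so its
-- (j + 1)-st point i W + (j + 1)(m + i) V + tri (j + 1) is affine in i: each column of
-- this m × m grid is an arithmetic progression.  Each of the M m grid points with
-- M ≤ i < 2M is the middle term of M progressions (rows i ± d, 1 ≤ d ≤ M), so A has at
-- least 3 M³ non-trivial 3-APs, while |A| ≤ 1 + m · 8m ≤ 73 M².

module Submission where

open import Defs
open import Data.Nat using (ℕ; zero; suc; _+_; _*_; _^_; _∸_; pred; _≤_; _<_; _≤?_; z≤n; s≤s; z<s)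
open import Data.Nat.Properties
open import Data.Nat.DivMod using (_/_; _%_; m≡m%n+[m/n]*n; m%n<n; m*n/n≡m; /-monoʳ-≤; m/n≤m)
open import Data.Nat.ListAction using (sum)
open import Data.Nat.ListAction.Properties using (sum-++)
open import Data.Nat.Tactic.RingSolver using (solve-∀)
open import Data.Integer as ℤ using (ℤ; +_; +<+)
import Data.Integer.Properties as ℤ
open import Data.List using (List; []; _∷_; _++_; length; map; applyUpTo)
open import Data.List.Properties using (length-++; length-map; length-applyUpTo; ++-assoc)
open import Data.List.Membership.Propositional using (_∈_)
open import Data.List.Membership.Propositional.Properties using (∈-++⁺ˡ; ∈-++⁺ʳ; ∈-map⁺)
open import Data.List.Relation.Unary.All as All using (All; []; _∷_)
import Data.List.Relation.Unary.All.Properties as All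
open import Data.List.Relation.Unary.All.Properties using (applyUpTo⁺₁)
import Data.List.Relation.Unary.AllPairs as AllPairs
open import Data.List.Relation.Unary.Any using (here; there)
open import Data.List.Relation.Unary.Linked as Linked using (Linked; []; [-]; _∷_)
import Data.List.Relation.Unary.Linked.Properties as Linked
open import Data.List.Relation.Binary.Sublist.Propositional using (_⊆_; []; _∷_; _∷ʳ_; minimum)
import Data.List.Relation.Binary.Sublist.Propositional.Properties as Sublist
open import Data.Bool using (true; false)
open import Data.Empty using (⊥-elim)
open import Data.Product using (Σ; _×_; _,_)
open import Data.Sum using (inj₁; inj₂)
open import Function using (_∘′_)
open import Relation.Nullary using (¬_; yes; no)
open import Relation.Nullary.Decidable using (from-yes)
open import Relation.Binary.PropositionalEquality

tri : ℕ → ℕ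
tri zero    = 0
tri (suc n) = n + tri n

tri-double : ∀ n → tri n + tri n + n ≡ n * n
tri-double zero    = refl
tri-double (suc n) = begin
  (n + tri n) + (n + tri n) + suc n  ≡⟨ regroup n (tri n) ⟩
  (tri n + tri n + n) + (2 * n + 1)  ≡⟨ cong (_+ (2 * n + 1)) (tri-double n) ⟩
  n * n + (2 * n + 1)                ≡⟨ square-suc n ⟩
  suc n * suc n                      ∎
  where
  open ≡-Reasoning
  regroup : ∀ n t → (n + t) + (n + t) + suc n ≡ (t + t + n) + (2 * n + 1)
  regroup = solve-∀
  square-suc : ∀ n → n * n + (2 * n + 1) ≡ suc n * suc n
  square-suc = solve-∀

tri+n≤n*n : ∀ n → tri n + n ≤ n * n
tri+n≤n*n n = subst (tri n + n ≤_) (tri-double n) (+-monoˡ-≤ n (m≤m+n (tri n) (tri n)))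

tri-mono-≤ : ∀ {m n} → m ≤ n → tri m ≤ tri n
tri-mono-≤ {zero}          _         = z≤n
tri-mono-≤ {suc m} {suc n} (s≤s m≤n) = +-mono-≤ m≤n (tri-mono-≤ m≤n)

run : ℕ → ℕ → List ℕ
run c zero    = []
run c (suc k) = c ∷ run (suc c) k

length-run : ∀ c k → length (run c k) ≡ k
length-run c zero    = refl
length-run c (suc k) = cong suc (length-run (suc c) k)

sum-run : ∀ c k → sum (run c k) ≡ k * c + tri k
sum-run c zero    = refl
sum-run c (suc k) = trans (cong (λ z → c + z) (sum-run (suc c) k)) (shift k c (tri k))
  where
  shift : ∀ k c t → c + (k * suc c + t) ≡ suc k * c + (k + t)
  shift = solve-∀

-- pred (c + k) is the last element of run c k; when k = 0 it is pred c, which is still ≥ b.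
run-++-linked : ∀ {b c} k {rest} → b < c → Linked _<_ (pred (c + k) ∷ rest) →
                Linked _<_ (b ∷ run c k ++ rest)
run-++-linked         zero _   [-]          = [-]
run-++-linked {b} {c} zero b<c (last<y ∷ l) = ≤-<-trans b≤pred[c+0] last<y ∷ l
  where
  b≤pred[c+0] : b ≤ pred (c + 0)
  b≤pred[c+0] = subst (λ z → b ≤ pred z) (sym (+-identityʳ c)) (<⇒≤pred b<c)
run-++-linked {c = c} (suc k) {rest} b<c l =
  b<c ∷ run-++-linked k (n<1+n c) (subst (λ z → Linked _<_ (pred z ∷ rest)) (+-suc c k) l)

partialSums : ℕ → List ℕ → List ℕ
partialSums b []       = []
partialSums b (d ∷ ds) = b + d ∷ partialSums (b + d) ds

length-partialSums : ∀ b ds → length (partialSums b ds) ≡ length ds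
length-partialSums b []       = refl
length-partialSums b (d ∷ ds) = cong suc (length-partialSums (b + d) ds)

partialSums-++ : ∀ b xs ys → partialSums b (xs ++ ys) ≡ partialSums b xs ++ partialSums (b + sum xs) ys
partialSums-++ b []       ys = cong (λ z → partialSums z ys) (sym (+-identityʳ b))
partialSums-++ b (d ∷ xs) ys = cong (b + d ∷_) (trans (partialSums-++ (b + d) xs ys)
  (cong (λ z → partialSums (b + d) xs ++ partialSums z ys) (+-assoc b d (sum xs))))

∈-partialSums-++ˡ : ∀ {x b} xs ys → x ∈ partialSums b xs → x ∈ partialSums b (xs ++ ys)
∈-partialSums-++ˡ {b = b} xs ys x∈ =
  subst (_ ∈_) (sym (partialSums-++ b xs ys)) (∈-++⁺ˡ x∈)

∈-partialSums-++ʳ : ∀ {x b} xs ys → x ∈ partialSums (b + sum xs) ys → x ∈ partialSums b (xs ++ ys)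
∈-partialSums-++ʳ {b = b} xs ys x∈ =
  subst (_ ∈_) (sym (partialSums-++ b xs ys)) (∈-++⁺ʳ (partialSums b xs) x∈)

∈-partialSums-run : ∀ b c {k j} → j < k → b + suc j * c + tri (suc j) ∈ partialSums b (run c k)
∈-partialSums-run b c {suc k} {zero}  _         = here (first b c)
  where
  first : ∀ b c → b + 1 * c + 0 ≡ b + c
  first = solve-∀
∈-partialSums-run b c {suc k} {suc j} (s≤s j<k) =
  there (subst (_∈ partialSums (b + c) (run (suc c) k)) (shift b c j (tri (suc j)))
          (∈-partialSums-run (b + c) (suc c) j<k))
  where
  shift : ∀ b c j t → (b + c) + suc j * suc c + t ≡ b + suc (suc j) * c + (suc j + t)
  shift = solve-∀

below-all : ∀ {x xs} → Linked _<_ (x ∷ xs) → All (x <_) xs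
below-all = AllPairs.head ∘′ Linked.Linked⇒AllPairs <-trans

diffs-partialSums : ∀ b ds → diffs (map +_ (b ∷ partialSums b ds)) ≡ map +_ ds
diffs-partialSums b []       = refl
diffs-partialSums b (d ∷ ds) = cong₂ _∷_ step (diffs-partialSums (b + d) ds)
  where
  step : + (b + d) ℤ.- + b ≡ + d
  step = trans (ℤ.[+m]-[+n]≡m⊖n (b + d) b)
           (trans (ℤ.⊖-≥ (m≤m+n b d)) (cong +_ (m+n∸m≡n b d)))

partialSums-linked : ∀ b {ds} → All (0 <_) ds → Linked _<_ (b ∷ partialSums b ds)
partialSums-linked b []                 = [-]
partialSums-linked b {d ∷ _} (0<d ∷ ps) = m<m+n b 0<d ∷ partialSums-linked (b + d) ps

increasing⇒positive : ∀ {e ds} → Linked _<_ (e ∷ ds) → All (0 <_) ds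
increasing⇒positive = All.map (≤-<-trans z≤n) ∘′ below-all

map-+-linked : ∀ {xs} → Linked _<_ xs → Linked ℤ._<_ (map +_ xs)
map-+-linked = Linked.map⁺ ∘′ Linked.map +<+

convex-partialSums : ∀ {e} b ds → Linked _<_ (e ∷ ds) → Convex (map +_ (b ∷ partialSums b ds))
convex-partialSums b ds e∷ds =
    map-+-linked (partialSums-linked b (increasing⇒positive e∷ds))
  , subst (Linked ℤ._<_) (sym (diffs-partialSums b ds)) (map-+-linked (Linked.tail e∷ds))

applyUpTo-++-linked : ∀ {R : ℕ → ℕ → Set} f k {rest} → (∀ i → R (f i) (f (suc i))) →
                      Linked R (f k ∷ rest) → Linked R (applyUpTo f (suc k) ++ rest)
applyUpTo-++-linked f zero    _  l = l
applyUpTo-++-linked f (suc k) Rf l = Rf 0 ∷ applyUpTo-++-linked (f ∘′ suc) k (λ i → Rf (suc i)) l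

∈-tail : ∀ {y ys zs} → All (y <_) zs → All (_∈ y ∷ ys) zs → All (_∈ ys) zs
∈-tail y<zs zs∈ = All.zipWith drop-head (y<zs , zs∈)
  where
  drop-head : ∀ {y ys z} → y < z × z ∈ y ∷ ys → z ∈ ys
  drop-head (y<z , here refl) = ⊥-elim (<-irrefl refl y<z)
  drop-head (_   , there z∈)  = z∈

sorted-⊆ : ∀ {xs ys} → Linked _<_ xs → Linked _<_ ys → All (_∈ ys) xs → xs ⊆ ys
sorted-⊆ {[]}             _  _  _                   = minimum _
sorted-⊆ {x ∷ xs} {y ∷ ys} sx sy (here refl  ∷ xs∈) =
  refl ∷ sorted-⊆ (Linked.tail sx) (Linked.tail sy) (∈-tail (below-all sx) xs∈)
sorted-⊆ {x ∷ xs} {y ∷ ys} sx sy (there x∈ys ∷ xs∈) =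
  y ∷ʳ sorted-⊆ sx (Linked.tail sy) (∈-tail y<x∷xs (there x∈ys ∷ xs∈))
  where
  y<x : y < x
  y<x = All.lookup (below-all sy) x∈ys
  y<x∷xs : All (y <_) (x ∷ xs)
  y<x∷xs = y<x ∷ All.map (<-trans y<x) (below-all sx)

sumOver-mono-⊆ : ∀ f {xs ys} → xs ⊆ ys → sumOver f xs ≤ sumOver f ys
sumOver-mono-⊆ f []          = z≤n
sumOver-mono-⊆ f (y ∷ʳ xs⊆)  = ≤-trans (sumOver-mono-⊆ f xs⊆) (m≤n+m _ (f y))
sumOver-mono-⊆ f (refl ∷ xs⊆) = +-monoʳ-≤ _ (sumOver-mono-⊆ f xs⊆)

length*≤sumOver : ∀ f {k xs} → All (λ x → k ≤ f x) xs → length xs * k ≤ sumOver f xs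
length*≤sumOver f []         = z≤n
length*≤sumOver f (k≤ ∷ k≤s) = +-mono-≤ k≤ (length*≤sumOver f k≤s)

countOver-pos : ∀ p {x xs} → x ∈ xs → p x ≡ true → 0 < countOver p xs
countOver-pos p {xs = y ∷ ys} (here refl) px rewrite px = s≤s z≤n
countOver-pos p {xs = y ∷ ys} (there x∈)  px with p y
... | true  = s≤s z≤n
... | false = countOver-pos p x∈ px

isNT3AP-true : ∀ {a b c} → (+ 2) ℤ.* a ≡ b ℤ.+ c → ¬ a ≡ b → isNT3AP a b c ≡ true
isNT3AP-true {a} {b} {c} ap a≢b with (+ 2) ℤ.* a ℤ.≟ b ℤ.+ c | a ℤ.≟ b
... | yes _   | no _    = refl
... | yes _   | yes a≡b = ⊥-elim (a≢b a≡b)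
... | no ¬ap  | _       = ⊥-elim (¬ap ap)

isNT3AP-+ : ∀ {a b c} → 2 * a ≡ b + c → ¬ a ≡ b → isNT3AP (+ a) (+ b) (+ c) ≡ true
isNT3AP-+ {a} {b} {c} ap a≢b =
  isNT3AP-true (trans (sym (ℤ.pos-* 2 a)) (trans (cong +_ ap) (ℤ.pos-+ b c))) (a≢b ∘′ ℤ.+-injective)

cube≤square : ∀ {n K M} a b q → a ^ 3 ≤ (q * b) ^ 2 → n ≤ a * M ^ 2 → b * M ^ 3 ≤ K →
              n ^ 3 ≤ (q * K) ^ 2
cube≤square {n} {K} {M} a b q a³≤[qb]² n≤aM² bM³≤K = begin
  n ^ 3                    ≤⟨ ^-monoˡ-≤ 3 n≤aM² ⟩
  (a * M ^ 2) ^ 3          ≡⟨ split a M ⟩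
  a ^ 3 * (M ^ 3) ^ 2      ≤⟨ *-monoˡ-≤ ((M ^ 3) ^ 2) a³≤[qb]² ⟩
  (q * b) ^ 2 * (M ^ 3) ^ 2 ≡⟨ merge q b M ⟩
  (q * (b * M ^ 3)) ^ 2    ≤⟨ ^-monoˡ-≤ 2 (*-monoʳ-≤ q bM³≤K) ⟩
  (q * K) ^ 2              ∎
  where
  open ≤-Reasoning
  split : ∀ a M → let x = a * (M * (M * 1)) ; y = M * (M * (M * 1)) in
          x * (x * (x * 1)) ≡ (a * (a * (a * 1))) * (y * (y * 1))
  split = solve-∀
  merge : ∀ q b M → let y = M * (M * (M * 1)) ; z = q * (b * y) in
          (q * b) * ((q * b) * 1) * (y * (y * 1)) ≡ z * (z * 1)
  merge = solve-∀

block-sum-formula : ∀ {ℓ ρ s V x c} → x + tri ℓ ≡ suc s * V + tri (suc ρ) → c + ρ ≡ suc s * V →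
                    (ℓ * (s * V) + tri ℓ) + (x + (ρ * c + tri ρ)) ≡ suc (ρ + (ℓ + suc ρ) * s) * V
block-sum-formula {ℓ} {ρ} {s} {V} {x} {c} x-eq c-eq = begin
  (L + tri ℓ) + (x + (ρ * c + tri ρ))    ≡⟨ regroup₁ L (tri ℓ) x (ρ * c) (tri ρ) ⟩
  L + (x + tri ℓ) + ρ * c + tri ρ        ≡⟨ cong (λ z → L + z + ρ * c + tri ρ) x-eq ⟩
  L + (S + (ρ + tri ρ)) + ρ * c + tri ρ  ≡⟨ regroup₂ L S ρ (ρ * c) (tri ρ) ⟩
  L + S + (tri ρ + tri ρ + ρ) + ρ * c    ≡⟨ cong (λ z → L + S + z + ρ * c) (tri-double ρ) ⟩
  L + S + ρ * ρ + ρ * c                  ≡⟨ regroup₃ L S ρ c ⟩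
  L + S + ρ * (c + ρ)                    ≡⟨ cong (λ z → L + S + ρ * z) c-eq ⟩
  L + S + ρ * S                          ≡⟨ collect ℓ ρ s V ⟩
  suc (ρ + (ℓ + suc ρ) * s) * V          ∎
  where
  open ≡-Reasoning
  L S : ℕ
  L = ℓ * (s * V)
  S = suc s * V
  regroup₁ : ∀ a t x b u → (a + t) + (x + (b + u)) ≡ a + (x + t) + b + u
  regroup₁ = solve-∀
  regroup₂ : ∀ a S ρ b u → a + (S + (ρ + u)) + b + u ≡ a + S + (u + u + ρ) + b
  regroup₂ = solve-∀
  regroup₃ : ∀ a S ρ c → a + S + ρ * ρ + ρ * c ≡ a + S + ρ * (c + ρ)
  regroup₃ = solve-∀
  collect : ∀ ℓ ρ s V → ℓ * (s * V) + suc s * V + ρ * (suc s * V) ≡ suc (ρ + (ℓ + suc ρ) * s) * V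
  collect = solve-∀

module Construction (N : ℕ) where

  M m Q V W : ℕ
  M = suc N
  m = M + (M + M)
  Q = 4 * m * (m + m)
  V = suc (Q * Q)
  W = suc Q * V

  -- Block i has slope s = m + i.  Writing Q = quot i * s + rem i, it consists of len i
  -- consecutive integers from s V, one filler, and rem i consecutive integers ending at
  -- (s + 1) V - 1: quot i numbers whose sum is Q V up to lower-order terms, which the
  -- filler corrects so that every block sums to W.
  quot rem len filler top : ℕ → ℕ
  quot i   = Q / (m + i)
  rem i    = Q % (m + i)
  len i    = quot i ∸ suc (rem i)
  filler i = suc (m + i) * V + tri (suc (rem i)) ∸ tri (len i)
  top i    = suc (m + i) * V ∸ rem i

  block : ℕ → List ℕ
  block i = run ((m + i) * V) (len i) ++ filler i ∷ run (top i) (rem i)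

  blocks : ℕ → ℕ → List ℕ
  blocks i zero    = []
  blocks i (suc k) = block i ++ blocks (suc i) k

  Aℕ : List ℕ
  Aℕ = 0 ∷ partialSums 0 (blocks 0 m)

  A : List ℤ
  A = map +_ Aℕ

  Q≡8m*m : Q ≡ 8 * m * m
  Q≡8m*m = regroup m
    where
    regroup : ∀ m → 4 * m * (m + m) ≡ 8 * m * m
    regroup = solve-∀

  m+m≤4m : m + m ≤ 4 * m
  m+m≤4m = +-monoʳ-≤ m (m≤m+n m (m + (m + 0)))

  m*[m+m]≤Q : m * (m + m) ≤ Q
  m*[m+m]≤Q = *-monoˡ-≤ (m + m) (m≤m+n m (3 * m))

  n+tri<V : ∀ {n} → n ≤ Q → n + tri n < V
  n+tri<V {n} n≤Q = s≤s (≤-trans (≤-reflexive (+-comm n (tri n)))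
                      (≤-trans (tri+n≤n*n n) (*-mono-≤ n≤Q n≤Q)))

  module Block {i} (i<m : i < m) where

    division : rem i + quot i * (m + i) ≡ Q
    division = sym (m≡m%n+[m/n]*n Q (m + i))

    rem<s : rem i < m + i
    rem<s = m%n<n Q (m + i)

    s<2m : m + i < m + m
    s<2m = +-monoʳ-< m i<m

    4m≤quot : 4 * m ≤ quot i
    4m≤quot = subst (_≤ quot i) (m*n/n≡m (4 * m) (m + m)) (/-monoʳ-≤ Q (<⇒≤ s<2m))

    quot≤8m : quot i ≤ 8 * m
    quot≤8m = subst (quot i ≤_) (trans (cong (_/ m) Q≡8m*m) (m*n/n≡m (8 * m) m))
                (/-monoʳ-≤ Q (m≤m+n m i))

    len+suc-rem : len i + suc (rem i) ≡ quot i
    len+suc-rem = m∸n+n≡m (≤-trans rem<s (≤-trans (<⇒≤ s<2m) (≤-trans m+m≤4m 4m≤quot)))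

    2m≤len : m + m ≤ len i
    2m≤len = +-cancelʳ-≤ (m + m) (m + m) (len i) (begin
      (m + m) + (m + m)    ≡⟨ doubling m ⟩
      4 * m                ≤⟨ 4m≤quot ⟩
      quot i               ≡⟨ len+suc-rem ⟨
      len i + suc (rem i)  ≤⟨ +-monoʳ-≤ (len i) (≤-trans rem<s (<⇒≤ s<2m)) ⟩
      len i + (m + m)      ∎)
      where
      open ≤-Reasoning
      doubling : ∀ m → (m + m) + (m + m) ≡ 4 * m
      doubling = solve-∀

    len+tri<V : len i + tri (len i) < V
    len+tri<V = n+tri<V (≤-trans (m∸n≤m (quot i) (suc (rem i))) (m/n≤m Q (m + i)))

    filler-eq : filler i + tri (len i) ≡ suc (m + i) * V + tri (suc (rem i))
    filler-eq = m∸n+n≡m (≤-trans (≤-trans (m≤n+m (tri (len i)) (len i)) (<⇒≤ len+tri<V))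
                  (≤-trans (m≤m+n V _) (m≤m+n _ _)))

    top-eq : top i + rem i ≡ suc (m + i) * V
    top-eq = m∸n+n≡m (≤-trans (<⇒≤ rem<s) (≤-trans (n≤1+n (m + i)) (m≤m*n (suc (m + i)) V)))

    sum-block : sum (block i) ≡ W
    sum-block = begin
      sum (block i)
        ≡⟨ sum-++ (run ((m + i) * V) (len i)) _ ⟩
      sum (run ((m + i) * V) (len i)) + (filler i + sum (run (top i) (rem i)))
        ≡⟨ cong₂ (λ u v → u + (filler i + v)) (sum-run ((m + i) * V) (len i)) (sum-run (top i) (rem i)) ⟩
      (len i * ((m + i) * V) + tri (len i)) + (filler i + (rem i * top i + tri (rem i)))
        ≡⟨ block-sum-formula {len i} {rem i} {m + i} {V} filler-eq top-eq ⟩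
      suc (rem i + (len i + suc (rem i)) * (m + i)) * V
        ≡⟨ cong (λ z → suc (rem i + z * (m + i)) * V) len+suc-rem ⟩
      suc (rem i + quot i * (m + i)) * V
        ≡⟨ cong (λ z → suc z * V) division ⟩
      W ∎
      where open ≡-Reasoning

    length-block : length (block i) ≡ quot i
    length-block = begin
      length (block i)
        ≡⟨ length-++ (run ((m + i) * V) (len i)) ⟩
      length (run ((m + i) * V) (len i)) + suc (length (run (top i) (rem i)))
        ≡⟨ cong₂ (λ u v → u + suc v) (length-run _ (len i)) (length-run _ (rem i)) ⟩
      len i + suc (rem i)
        ≡⟨ len+suc-rem ⟩
      quot i ∎
      where open ≡-Reasoning

    run-end<filler : pred ((m + i) * V + len i) < filler i
    run-end<filler = ≤-<-trans (pred[n]≤n {(m + i) * V + len i}) (+-cancelʳ-< (tri (len i)) _ _ (begin-strict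
      (m + i) * V + len i + tri (len i)    ≡⟨ +-assoc ((m + i) * V) (len i) _ ⟩
      (m + i) * V + (len i + tri (len i))  <⟨ +-monoʳ-< ((m + i) * V) len+tri<V ⟩
      (m + i) * V + V                      ≡⟨ +-comm ((m + i) * V) V ⟩
      suc (m + i) * V                      ≤⟨ m≤m+n _ _ ⟩
      suc (m + i) * V + tri (suc (rem i))  ≡⟨ filler-eq ⟨
      filler i + tri (len i)               ∎))
      where open ≤-Reasoning

    filler<top : filler i < top i
    filler<top = +-cancelʳ-< (tri (suc (suc (rem i)))) _ _ (begin-strict
      filler i + tri (suc (suc (rem i)))    ≤⟨ +-monoʳ-≤ (filler i) (tri-mono-≤ ss-rem≤len) ⟩
      filler i + tri (len i)                ≡⟨ filler-eq ⟩
      suc (m + i) * V + tri (suc (rem i))   ≡⟨ cong (_+ tri (suc (rem i))) top-eq ⟨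
      top i + rem i + tri (suc (rem i))     ≡⟨ +-assoc (top i) (rem i) _ ⟩
      top i + (rem i + tri (suc (rem i)))   <⟨ +-monoʳ-< (top i) (n<1+n _) ⟩
      top i + tri (suc (suc (rem i)))       ∎)
      where
      open ≤-Reasoning
      ss-rem≤len : suc (suc (rem i)) ≤ len i
      ss-rem≤len = ≤-trans (s≤s rem<s) (≤-trans s<2m 2m≤len)

  blocks-linked : ∀ k {i} → i + k ≤ m → Linked _<_ (pred ((m + i) * V) ∷ blocks i k)
  blocks-linked zero        _     = [-]
  blocks-linked (suc k) {i} i+k≤m =
    subst (λ xs → Linked _<_ (pred ((m + i) * V) ∷ xs))
      (sym (++-assoc (run ((m + i) * V) (len i)) (filler i ∷ run (top i) (rem i)) (blocks (suc i) k)))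
      (run-++-linked (len i) ≤-refl
        (run-end<filler ∷ run-++-linked (rem i) filler<top
          (subst (λ z → Linked _<_ (pred z ∷ blocks (suc i) k)) (sym top-eq′)
            (blocks-linked k (subst (_≤ m) (+-suc i k) i+k≤m)))))
    where
    open Block (<-≤-trans (m<m+n i z<s) i+k≤m)
    top-eq′ : top i + rem i ≡ (m + suc i) * V
    top-eq′ = trans top-eq (cong (_* V) (sym (+-suc m i)))

  length-blocks : ∀ k {i} → i + k ≤ m → length (blocks i k) ≤ k * (8 * m)
  length-blocks zero        _     = z≤n
  length-blocks (suc k) {i} i+k≤m = begin
    length (block i ++ blocks (suc i) k)        ≡⟨ length-++ (block i) ⟩
    length (block i) + length (blocks (suc i) k) ≤⟨ +-mono-≤ (≤-trans (≤-reflexive length-block) quot≤8m)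
                                                            (length-blocks k (subst (_≤ m) (+-suc i k) i+k≤m)) ⟩
    8 * m + k * (8 * m)                          ∎
    where
    open ≤-Reasoning
    open Block (<-≤-trans (m<m+n i z<s) i+k≤m)

  convex-A : Convex A
  convex-A = convex-partialSums 0 (blocks 0 m) (blocks-linked m ≤-refl)

  linked-Aℕ : Linked _<_ Aℕ
  linked-Aℕ = partialSums-linked 0 (increasing⇒positive (blocks-linked m ≤-refl))

  length-A : length A ≤ 73 * M ^ 2
  length-A = begin
    length (map +_ Aℕ)               ≡⟨ length-map +_ Aℕ ⟩
    suc (length (partialSums 0 ds))  ≡⟨ cong suc (length-partialSums 0 ds) ⟩
    suc (length ds)                  ≤⟨ s≤s (length-blocks m ≤-refl) ⟩
    suc (m * (8 * m))                ≡⟨ cong suc (m*8m≡72M² M) ⟩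
    1 + 72 * M ^ 2                   ≤⟨ +-monoˡ-≤ (72 * M ^ 2) (s≤s z≤n) ⟩
    M ^ 2 + 72 * M ^ 2               ∎
    where
    open ≤-Reasoning
    ds : List ℕ
    ds = blocks 0 m
    m*8m≡72M² : ∀ M → (M + (M + M)) * (8 * (M + (M + M))) ≡ 72 * (M * (M * 1))
    m*8m≡72M² = solve-∀

  point : ℕ → ℕ → ℕ
  point i j = i * W + suc j * ((m + i) * V) + tri (suc j)

  point-∈-blocks : ∀ k {i r j} → i + k ≤ m → i ≤ r → r < i + k → j < len r →
                   point r j ∈ partialSums (i * W) (blocks i k)
  point-∈-blocks zero    {i} {r} _ i≤r r<i+0 _ =
    ⊥-elim (<-irrefl refl (≤-<-trans i≤r (subst (r <_) (+-identityʳ i) r<i+0)))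
  point-∈-blocks (suc k) {i} {r} {j} i+k≤m i≤r r<i+k j<len with m≤n⇒m<n∨m≡n i≤r
  ... | inj₂ refl =
    ∈-partialSums-++ˡ (block i) _ (∈-partialSums-++ˡ (run ((m + i) * V) (len i)) _
      (∈-partialSums-run (i * W) ((m + i) * V) j<len))
  ... | inj₁ i<r  =
    ∈-partialSums-++ʳ (block i) _
      (subst (λ b → point r j ∈ partialSums b (blocks (suc i) k)) (sym next-start)
        (point-∈-blocks k (subst (_≤ m) (+-suc i k) i+k≤m) i<r (subst (r <_) (+-suc i k) r<i+k) j<len))
    where
    open Block (<-≤-trans (m<m+n i z<s) i+k≤m)
    next-start : i * W + sum (block i) ≡ suc i * W
    next-start = trans (cong (λ z → i * W + z) sum-block) (+-comm (i * W) W)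

  point-∈ : ∀ {i j} → i < m → j < m → point i j ∈ Aℕ
  point-∈ {i} i<m j<m = there (point-∈-blocks m ≤-refl z≤n i<m
    (<-≤-trans j<m (≤-trans (m≤m+n m m) (Block.2m≤len i<m))))

  point-shift : ∀ e r j → point (e + r) j ≡ point r j + e * (W + suc j * V)
  point-shift e r j = shift e r W (suc j) m V (tri (suc j))
    where
    shift : ∀ e r W J m V t → (e + r) * W + J * ((m + (e + r)) * V) + t ≡
                              (r * W + J * ((m + r) * V) + t) + e * (W + J * V)
    shift = solve-∀

  point-<-shift : ∀ d r j → point r j < point (suc d + r) j
  point-<-shift d r j = subst (point r j <_) (sym (point-shift (suc d) r j)) (m<m+n (point r j) z<s)

  point-<-next-in-row : ∀ r j → point r j < point r (suc j)
  point-<-next-in-row r j = subst (point r j <_) (sym (next (r * W) ((m + r) * V) (suc j) (tri (suc j))))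
    (m<m+n (point r j) (s≤s z≤n))
    where
    next : ∀ a S J t → a + suc J * S + (J + t) ≡ (a + J * S + t) + (S + J)
    next = solve-∀

  row-end<next-row-start : ∀ {r} → r ≤ m → point r (pred m) < point (suc r) 0
  row-end<next-row-start {r} r≤m = begin-strict
    r * W + m * ((m + r) * V) + tri m    ≡⟨ +-assoc (r * W) _ _ ⟩
    r * W + (m * ((m + r) * V) + tri m)  <⟨ +-monoʳ-< (r * W) (+-mono-≤-< row-span≤QV tri-m<V) ⟩
    r * W + (Q * V + V)                  ≡⟨ cong (λ z → r * W + z) (+-comm (Q * V) V) ⟩
    r * W + W                            ≡⟨ +-comm (r * W) W ⟩
    suc r * W                            ≤⟨ m≤m+n (suc r * W) _ ⟩
    suc r * W + 1 * ((m + suc r) * V)    ≤⟨ m≤m+n _ (tri 1) ⟩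
    point (suc r) 0                      ∎
    where
    open ≤-Reasoning
    row-span≤QV : m * ((m + r) * V) ≤ Q * V
    row-span≤QV = subst (_≤ Q * V) (*-assoc m (m + r) V)
      (*-monoˡ-≤ V (≤-trans (*-monoʳ-≤ m (+-monoʳ-≤ m r≤m)) m*[m+m]≤Q))
    tri-m<V : tri m < V
    tri-m<V = ≤-<-trans (m≤n+m (tri m) m) (n+tri<V (≤-trans (m≤m*n m (m + m)) m*[m+m]≤Q))

  point-AP : ∀ e w j → 2 * point (e + w) j ≡ point (e + (e + w)) j + point w j
  point-AP e w j = begin
    2 * point (e + w) j                ≡⟨ cong (2 *_) (point-shift e w j) ⟩
    2 * (point w j + δ)                ≡⟨ symmetric (point w j) δ ⟩
    (point w j + δ) + δ + point w j    ≡⟨ cong (λ z → z + δ + point w j) (point-shift e w j) ⟨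
    point (e + w) j + δ + point w j    ≡⟨ cong (_+ point w j) (point-shift e (e + w) j) ⟨
    point (e + (e + w)) j + point w j  ∎
    where
    open ≡-Reasoning
    δ : ℕ
    δ = e * (W + suc j * V)
    symmetric : ∀ p δ → 2 * (p + δ) ≡ (p + δ) + δ + p
    symmetric = solve-∀

  grid : ℕ → ℕ → List ℕ
  grid i zero    = []
  grid i (suc k) = applyUpTo (point i) m ++ grid (suc i) k

  grid-linked : ∀ k {i} → i + k ≤ m → Linked _<_ (grid i k)
  grid-linked zero              _     = []
  grid-linked (suc zero)    {i} _     = applyUpTo-++-linked (point i) (pred m) (point-<-next-in-row i) [-]
  grid-linked (suc (suc k)) {i} i+k≤m = applyUpTo-++-linked (point i) (pred m) (point-<-next-in-row i)
    (row-end<next-row-start (≤-trans (m≤m+n i _) i+k≤m)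
      ∷ grid-linked (suc k) (subst (_≤ m) (+-suc i (suc k)) i+k≤m))

  grid-∈ : ∀ k {i} → i + k ≤ m → All (_∈ Aℕ) (grid i k)
  grid-∈ zero        _     = []
  grid-∈ (suc k) {i} i+k≤m =
    All.++⁺ (applyUpTo⁺₁ (point i) m (point-∈ (<-≤-trans (m<m+n i z<s) i+k≤m)))
            (grid-∈ k (subst (_≤ m) (+-suc i k) i+k≤m))

  length-grid : ∀ k i → length (grid i k) ≡ k * m
  length-grid zero    i = refl
  length-grid (suc k) i = trans (length-++ (applyUpTo (point i) m))
    (cong₂ _+_ (length-applyUpTo (point i) m) (length-grid k (suc i)))

  M+M≤m : M + M ≤ m
  M+M≤m = +-monoʳ-≤ M (m≤n+m M M)

  grid⊆Aℕ : grid M M ⊆ Aℕ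
  grid⊆Aℕ = sorted-⊆ (grid-linked M M+M≤m) linked-Aℕ (grid-∈ M M+M≤m)

  partners : ℤ → ℕ
  partners a = sumOver (λ b → countOver (isNT3AP a b) A) A

  M≤partners : ∀ {i j} → M ≤ i → M + i < m → j < m → M ≤ partners (+ point i j)
  M≤partners {i} {j} M≤i M+i<m j<m = begin
    M                          ≡⟨ trans (length-map +_ above) (length-applyUpTo upper M) ⟨
    length (map +_ above)      ≡⟨ *-identityʳ _ ⟨
    length (map +_ above) * 1  ≤⟨ length*≤sumOver G (All.map⁺ (applyUpTo⁺₁ _ M has-partner)) ⟩
    sumOver G (map +_ above)   ≤⟨ sumOver-mono-⊆ G (Sublist.map⁺ +_ above⊆Aℕ) ⟩
    partners (+ point i j)     ∎
    where
    open ≤-Reasoning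
    G : ℤ → ℕ
    G b = countOver (isNT3AP (+ point i j) b) A
    upper : ℕ → ℕ
    upper d = point (suc d + i) j
    above : List ℕ
    above = applyUpTo upper M
    above⊆Aℕ : above ⊆ Aℕ
    above⊆Aℕ = sorted-⊆ (Linked.applyUpTo⁺₂ _ M (λ d → point-<-shift 0 (suc d + i) j)) linked-Aℕ
      (applyUpTo⁺₁ _ M (λ d<M → point-∈ (≤-<-trans (+-monoˡ-≤ i d<M) M+i<m) j<m))
    has-partner : ∀ {d} → d < M → 1 ≤ G (+ upper d)
    has-partner {d} d<M = countOver-pos _ (∈-map⁺ +_ (point-∈ (≤-<-trans (m∸n≤m i (suc d)) i<m) j<m))
      (isNT3AP-+ ap (<⇒≢ (point-<-shift d i j)))
      where
      i<m : i < m
      i<m = ≤-<-trans (m≤n+m i M) M+i<m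
      ap : 2 * point i j ≡ point (suc d + i) j + point (i ∸ suc d) j
      ap = subst (λ r → 2 * point r j ≡ point (suc d + r) j + point (i ∸ suc d) j)
             (m+[n∸m]≡n (≤-trans d<M M≤i)) (point-AP (suc d) (i ∸ suc d) j)

  grid-M≤partners : ∀ k {i} → M ≤ i → i + k ≤ M + M → All (λ a → M ≤ partners (+ a)) (grid i k)
  grid-M≤partners zero        _   _      = []
  grid-M≤partners (suc k) {i} M≤i i+k≤2M =
    All.++⁺ (applyUpTo⁺₁ (point i) m (M≤partners M≤i (+-monoʳ-< M (<-≤-trans (m<m+n i z<s) i+k≤2M))))
            (grid-M≤partners k (m≤n⇒m≤1+n M≤i) (subst (_≤ M + M) (+-suc i k) i+k≤2M))

  count-A : 3 * M ^ 3 ≤ numNT3AP A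
  count-A = begin
    3 * M ^ 3
      ≡⟨ cubic M ⟩
    M * m * M
      ≡⟨ cong (_* M) (trans (length-map +_ (grid M M)) (length-grid M M)) ⟨
    length (map +_ (grid M M)) * M
      ≤⟨ length*≤sumOver partners (All.map⁺ (grid-M≤partners M ≤-refl ≤-refl)) ⟩
    sumOver partners (map +_ (grid M M))
      ≤⟨ sumOver-mono-⊆ partners (Sublist.map⁺ +_ grid⊆Aℕ) ⟩
    numNT3AP A ∎
    where
    open ≤-Reasoning
    cubic : ∀ M → 3 * (M * (M * (M * 1))) ≡ M * (M + (M + M)) * M
    cubic = solve-∀

  N≤length-A : N ≤ length A
  N≤length-A = begin
    N                  ≤⟨ n≤1+n N ⟩
    M                  ≤⟨ m≤m*n M m ⟩
    M * m              ≡⟨ length-grid M M ⟨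
    length (grid M M)  ≤⟨ Sublist.length-mono-≤ grid⊆Aℕ ⟩
    length Aℕ          ≡⟨ length-map +_ Aℕ ⟨
    length A           ∎
    where open ≤-Reasoning

theorem1p2 : Σ ℕ λ p → Σ ℕ λ q → 0 < p × 0 < q ×
    ((N : ℕ) → Σ (List ℤ) λ A → Convex A × N ≤ length A ×
      p ^ 2 * length A ^ 3 ≤ (q * numNT3AP A) ^ 2)
theorem1p2 = 1 , 300 , z<s , z<s , λ N → let open Construction N in
  A , convex-A , N≤length-A ,
  subst (_≤ (300 * numNT3AP A) ^ 2) (sym (*-identityˡ (length A ^ 3)))
    (cube≤square {M = M} 73 3 300 (from-yes (73 ^ 3 ≤? (300 * 3) ^ 2)) length-A count-A)
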